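{- Let $G$ be a graph with Gallai–Edmonds decomposition $(D,A,C)$, let $\ell$ be an integer, and for an instance $(H,\ell)$ let $\mu(H,\ell) = \frac{1}{2}(\mathsf{MM}(H) + \mathsf{IS}(H)) - \ell$. Let $v \in C$ have two distinct neighbors $u, w$. Then for each $G_i \in \{G - v, G - u, G - w\}$ we have $\mu(G_i,\ell) \le \mu(G,\ell) - \frac{1}{2}$.
   Context: All graphs are finite, simple and undirected. $\mathsf{MM}(G)$ denotes the maximum size of a matching of $G$, $\mathsf{IS}(G)$ the maximum size of an independent set. The Gallai–Edmonds decomposition of $G$ is the partition of $V(G)$ into $D = \{v : \text{some maximum matching of } G \text{ misses } v\}$, $A = N(D)$ (the vertices outside $D$ adjacent to some vertex of $D$), and $C = V(G) \setminus (A \cup D)$. -}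

module Defs where

open import Level using (0ℓ)
open import Data.Nat as ℕ using (ℕ; suc; _+_)
open import Data.Integer as ℤ using (ℤ; +_)
open import Data.Rational as ℚ using (ℚ; _/_; _-_; ½)
open import Data.Fin using (Fin; punchIn)
open import Data.Product using (_×_; _,_; Σ; ∃; ∃-syntax; proj₁; proj₂)
open import Data.List using (List; []; _∷_; length; _++_; concatMap)
open import Data.List.Relation.Unary.All using (All)
open import Data.List.Relation.Unary.Unique.Propositional using (Unique)
open import Data.List.Relation.Unary.AllPairs using (AllPairs)
open import Relation.Nullary using (¬_)
open import Relation.Binary.PropositionalEquality using (_≡_)

record Graph (n : ℕ) : Set₁ where
  field
    Adj   : Fin n → Fin n → Set
    sym   : ∀ {x y} → Adj x y → Adj y x
    irrefl : ∀ {x} → ¬ Adj x x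
open Graph public

-- Vertex deletion G - v : the induced subgraph on the remaining n vertices,
-- relabelled via punchIn v.
_─_ : ∀ {n} → Graph (suc n) → Fin (suc n) → Graph n
Adj (G ─ v) i j = Adj G (punchIn v i) (punchIn v j)
sym (G ─ v) = sym G
irrefl (G ─ v) = irrefl G

endpoints : ∀ {n} → List (Fin n × Fin n) → List (Fin n)
endpoints = concatMap (λ e → proj₁ e ∷ proj₂ e ∷ [])

IsMatching : ∀ {n} → Graph n → List (Fin n × Fin n) → Set
IsMatching G M = All (λ e → Adj G (proj₁ e) (proj₂ e)) M × Unique (endpoints M)

IsMaximumMatching : ∀ {n} → Graph n → List (Fin n × Fin n) → Set
IsMaximumMatching G M =
  IsMatching G M × (∀ M' → IsMatching G M' → length M' ℕ.≤ length M)

IsMM : ∀ {n} → Graph n → ℕ → Set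
IsMM G k = Σ _ λ M → IsMaximumMatching G M × length M ≡ k

IsIndependent : ∀ {n} → Graph n → List (Fin n) → Set
IsIndependent G I = Unique I × AllPairs (λ x y → ¬ Adj G x y) I

IsIS : ∀ {n} → Graph n → ℕ → Set
IsIS G k = Σ _ λ I → IsIndependent G I × length I ≡ k
         × (∀ J → IsIndependent G J → length J ℕ.≤ k)

Covers : ∀ {n} → List (Fin n × Fin n) → Fin n → Set
Covers M v = v Data.List.Membership.Propositional.∈ endpoints M
  where import Data.List.Membership.Propositional

InD : ∀ {n} → Graph n → Fin n → Set
InD G v = ∃[ M ] IsMaximumMatching G M × ¬ Covers M v

InA : ∀ {n} → Graph n → Fin n → Set
InA G v = ¬ InD G v × ∃[ d ] InD G d × Adj G v d

InC : ∀ {n} → Graph n → Fin n → Set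
InC G v = ¬ InA G v × ¬ InD G v

-- μ(H, ℓ) = (MM(H) + IS(H)) / 2 - ℓ, as a function of the values MM(H), IS(H).
μ : ℕ → ℕ → ℤ → ℚ
μ mm is ℓ = (+ (mm + is)) / 2 - (ℓ / 1)

-- A vertex of C has no neighbour in D (such a neighbour would put it in A), so v, u and w all
-- lie outside D: every maximum matching covers them, and deleting one of them lowers MM by at
-- least one. Deleting a vertex never raises IS, hence μ drops by at least ½.
module Submission where

open import Defs
open import Data.Nat as ℕ using (ℕ; suc)
open import Data.Integer as ℤ using (ℤ; +_)
open import Data.Rational using (ℚ; _/_; _+_; _-_; -_; _≤_; ½; toℚᵘ)
open import Data.Rational.Unnormalised as ℚᵘ using (mkℚᵘ; *≡*; *≤*)
open import Data.Fin using (Fin; punchIn)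
open import Data.Fin.Properties using (punchIn-injective; punchInᵢ≢i)
open import Data.Product as Product using (_×_; _,_; proj₁; proj₂)
open import Data.Sum using (_⊎_; inj₁; inj₂)
open import Data.List using (List; []; _∷_; length; map)
open import Data.List.Properties using (length-map)
open import Data.List.Membership.Propositional using (_∈_)
open import Data.List.Membership.Propositional.Properties using (∈-map⁻)
open import Data.List.Relation.Unary.Unique.Propositional using (Unique)
open import Relation.Nullary using (¬_; contradiction; yes; no)
open import Relation.Binary.PropositionalEquality using (_≡_; refl; cong; subst; module ≡-Reasoning)

import Data.Nat.Properties as ℕ
import Data.Integer.Properties as ℤ
open import Data.Integer.Tactic.RingSolver using (solve-∀)
open import Data.Rational.Properties
  using (toℚᵘ-injective; toℚᵘ-fromℚᵘ; toℚᵘ-homo-+; toℚᵘ-cancel-≤; +-monoˡ-≤)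
open import Data.Rational.Solver using (module +-*-Solver)
import Data.Rational.Unnormalised.Properties as ℚᵘ
import Data.List.Relation.Unary.All.Properties as All
import Data.List.Relation.Unary.AllPairs.Properties as AllPairs
import Data.List.Relation.Unary.Unique.Propositional.Properties as Unique
import Relation.Binary.PropositionalEquality as ≡

-- half k is definitionally fromℚᵘ (mkℚᵘ (+ k) 1), which is how it is computed with below.
half : ℕ → ℚ
half k = + k / 2

half-suc : ∀ k → half (suc k) ≡ half k + ½
half-suc k = toℚᵘ-injective (begin
  toℚᵘ (half (suc k))                 ≈⟨ toℚᵘ-fromℚᵘ (mkℚᵘ (+ suc k) 1) ⟩
  mkℚᵘ (+ suc k) 1                     ≈⟨ *≡* (cross-multiplied (+ k)) ⟩
  mkℚᵘ (+ k) 1 ℚᵘ.+ mkℚᵘ (+ 1) 1       ≈⟨ ℚᵘ.+-cong (toℚᵘ-fromℚᵘ (mkℚᵘ (+ k) 1))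
                                                    (toℚᵘ-fromℚᵘ (mkℚᵘ (+ 1) 1)) ⟨
  toℚᵘ (half k) ℚᵘ.+ toℚᵘ ½            ≈⟨ toℚᵘ-homo-+ (half k) ½ ⟨
  toℚᵘ (half k + ½)                    ∎)
  where
  open ℚᵘ.≃-Reasoning
  cross-multiplied : ∀ (k : ℤ) → (ℤ.1ℤ ℤ.+ k) ℤ.* + 4 ≡ (k ℤ.* + 2 ℤ.+ ℤ.1ℤ ℤ.* + 2) ℤ.* + 2
  cross-multiplied = solve-∀

half-mono-≤ : ∀ {k m} → k ℕ.≤ m → half k ≤ half m
half-mono-≤ {k} {m} k≤m = toℚᵘ-cancel-≤ (begin
  toℚᵘ (half k)      ≃⟨ toℚᵘ-fromℚᵘ (mkℚᵘ (+ k) 1) ⟩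
  mkℚᵘ (+ k) 1       ≤⟨ *≤* (ℤ.*-monoʳ-≤-nonNeg (+ 2) (ℤ.+≤+ k≤m)) ⟩
  mkℚᵘ (+ m) 1       ≃⟨ toℚᵘ-fromℚᵘ (mkℚᵘ (+ m) 1) ⟨
  toℚᵘ (half m)      ∎)
  where open ℚᵘ.≤-Reasoning

μ-mono-≤ : ∀ {a b c d} ℓ → a ℕ.≤ c → b ℕ.≤ d → μ a b ℓ ≤ μ c d ℓ
μ-mono-≤ ℓ a≤c b≤d = +-monoˡ-≤ (- (ℓ / 1)) (half-mono-≤ (ℕ.+-mono-≤ a≤c b≤d))

μ-suc : ∀ a b ℓ → μ (suc a) b ℓ ≡ μ a b ℓ + ½
μ-suc a b ℓ = begin
  half (suc (a ℕ.+ b)) - L   ≡⟨ cong (_- L) (half-suc (a ℕ.+ b)) ⟩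
  (half (a ℕ.+ b) + ½) - L   ≡⟨ solve 3 (λ h r l → (h :+ r) :- l := (h :- l) :+ r)
                                       refl (half (a ℕ.+ b)) ½ L ⟩
  (half (a ℕ.+ b) - L) + ½   ∎
  where
  L = ℓ / 1
  open ≡-Reasoning
  open +-*-Solver

p+r≤q⇒p≤q-r : ∀ {p q} r → p + r ≤ q → p ≤ q - r
p+r≤q⇒p≤q-r {p} {q} r p+r≤q =
  subst (_≤ q - r) (solve 2 (λ p r → (p :+ r) :- r := p) refl p r) (+-monoˡ-≤ (- r) p+r≤q)
  where open +-*-Solver

μ-drop : ∀ {a b c d} ℓ → c ℕ.< a → d ℕ.≤ b → μ c d ℓ ≤ μ a b ℓ - ½
μ-drop {a} {b} {c} {d} ℓ c<a d≤b =
  p+r≤q⇒p≤q-r ½ (subst (_≤ μ a b ℓ) (μ-suc c d ℓ) (μ-mono-≤ ℓ c<a d≤b))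

endpoints-map : ∀ {m n} (f : Fin m → Fin n) M →
                endpoints (map (Product.map f f) M) ≡ map f (endpoints M)
endpoints-map f []      = refl
endpoints-map f (e ∷ M) = cong (λ es → f (proj₁ e) ∷ f (proj₂ e) ∷ es) (endpoints-map f M)

module _ {n} (G : Graph (suc n)) (x : Fin (suc n)) where

  private
    lift : List (Fin n × Fin n) → List (Fin (suc n) × Fin (suc n))
    lift = map (Product.map (punchIn x) (punchIn x))

    punchIn-inj : ∀ {i j} → punchIn x i ≡ punchIn x j → i ≡ j
    punchIn-inj = punchIn-injective x _ _

  ─-matching : ∀ {M} → IsMatching (G ─ x) M → IsMatching G (lift M)
  ─-matching {M} (edges , unique) =
    All.map⁺ edges ,
    subst Unique (≡.sym (endpoints-map (punchIn x) M)) (Unique.map⁺ punchIn-inj unique)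

  ─-matching-avoids : ∀ M → ¬ Covers (lift M) x
  ─-matching-avoids M x∈ with ∈-map⁻ (punchIn x) (subst (x ∈_) (endpoints-map (punchIn x) M) x∈)
  ... | i , _ , x≡i = punchInᵢ≢i x i (≡.sym x≡i)

  ─-independent : ∀ {I} → IsIndependent (G ─ x) I → IsIndependent G (map (punchIn x) I)
  ─-independent (unique , nonAdj) = Unique.map⁺ punchIn-inj unique , AllPairs.map⁺ nonAdj

  IS-─-≤ : ∀ {is isx} → IsIS G is → IsIS (G ─ x) isx → isx ℕ.≤ is
  IS-─-≤ (_ , _ , _ , maximal) (I , indep , refl , _) =
    subst (ℕ._≤ _) (length-map (punchIn x) I) (maximal _ (─-independent indep))

  -- A maximum matching of G ─ x of size MM(G) would be a maximum matching of G missing x.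
  MM-─-< : ¬ InD G x → ∀ {mm mmx} → IsMM G mm → IsMM (G ─ x) mmx → mmx ℕ.< mm
  MM-─-< x∉D {mm} {mmx} (M , (_ , maximum) , refl) (M′ , (matching′ , _) , refl) with mm ℕ.≤? mmx
  ... | no mm≰mmx = ℕ.≰⇒> mm≰mmx
  ... | yes mm≤mmx =
    contradiction (lift M′ , (─-matching matching′ , maximum′) , ─-matching-avoids M′) x∉D
    where
    maximum′ : ∀ M″ → IsMatching G M″ → length M″ ℕ.≤ length (lift M′)
    maximum′ M″ matching″ = ℕ.≤-trans (maximum M″ matching″)
      (subst (mm ℕ.≤_) (≡.sym (length-map _ M′)) mm≤mmx)

InC⇒neighbour-∉D : ∀ {n} (G : Graph n) {v u} → InC G v → Adj G v u → ¬ InD G u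
InC⇒neighbour-∉D G (v∉A , v∉D) vu u∈D = v∉A (v∉D , _ , u∈D , vu)

lemma6 : ∀ {n} (G : Graph (suc n)) (ℓ : ℤ) (v u w : Fin (suc n)) →
         InC G v → Adj G v u → Adj G v w → ¬ u ≡ w →
         ∀ (x : Fin (suc n)) → x ≡ v ⊎ x ≡ u ⊎ x ≡ w →
         ∀ (mm is mmx isx : ℕ) → IsMM G mm → IsIS G is →
         IsMM (G ─ x) mmx → IsIS (G ─ x) isx →
         μ mmx isx ℓ ≤ μ mm is ℓ - ½
lemma6 G ℓ v u w v∈C vu vw _ x x∈vuw _ _ _ _ MM IS MMx ISx =
  μ-drop ℓ (MM-─-< G x (x∉D x∈vuw) MM MMx) (IS-─-≤ G x IS ISx)
  where
  x∉D : x ≡ v ⊎ x ≡ u ⊎ x ≡ w → ¬ InD G x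
  x∉D (inj₁ refl)        = proj₂ v∈C
  x∉D (inj₂ (inj₁ refl)) = InC⇒neighbour-∉D G v∈C vu
  x∉D (inj₂ (inj₂ refl)) = InC⇒neighbour-∉D G v∈C vw
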